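{- Let $(G,\chi)$ be a $1$-robust colored graph with $|V(G)|>1$. Let $c\in\mathrm{im}(\chi)$ and set $\xi:=\deg_{G[[\chi]]}(c)+1$. Then $|\mathrm{im}(\chi_{1,u})|\ge|\mathrm{im}(\chi)|+\xi$ for every $u\in\chi^{ -1}(c)$.
   Context: $\mathrm{im}(\chi)$ is the set of colors of $\chi$. $1$-WL (color refinement) iteratively recolors each vertex by the pair (old color, multiset of old colors of neighbors) until stable; $\chi[u]$ gives $u$ a new unique color and $\chi_{1,u}$ is the stable $1$-WL coloring of $(G,\chi[u])$. $\chi$ is stable with respect to $1$-WL if color refinement does not split its classes. $(G,\chi)$ is flipped if for all colors $c_1,c_2$ the number of edges between $\chi^{ -1}(c_1)$ and $\chi^{ -1}(c_2)$ is at most half the number of unordered pairs $\{v,w\}$ of distinct vertices with $\chi(v)=c_1$, $\chi(w)=c_2$. $(G,\chi)$ is $1$-robust if $G$ is connected, $(G,\chi)$ is flipped, and $\chi$ is stable with respect to $1$-WL. $G[[\chi]]$ is the graph on vertex set $\mathrm{im}(\chi)$ with an edge (possibly a loop) $(c_1,c_2)$ whenever $G$ has an edge between $\chi^{ -1}(c_1)$ and $\chi^{ -1}(c_2)$; $\deg_{G[[\chi]]}(c_1)$ is the number of colors $c_2$ (including $c_1$ itself if there is a loop) with $(c_1,c_2)$ an edge. -}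

module Defs where

open import Data.Nat using (ℕ; zero; suc; _+_; _*_; _≤_; _<_; _≡ᵇ_; _<ᵇ_)
open import Data.Bool using (Bool; true; false; _∧_; _∨_; not; if_then_else_; T)
open import Data.Fin using (Fin; toℕ; _≟_)
open import Data.List using (List; map; foldr)
open import Data.Nat.ListAction using (sum)
open import Data.List.Base using (allFin)
open import Relation.Nullary.Decidable using (⌊_⌋)
open import Relation.Binary.PropositionalEquality using (_≡_)
open import Data.Product using (_×_; ∃)

count : {n : ℕ} → (Fin n → Bool) → ℕ
count {n} p = sum (map (λ i → if p i then 1 else 0) (allFin n))

anyF : {n : ℕ} → (Fin n → Bool) → Bool
anyF {n} p = foldr (λ i b → p i ∨ b) false (allFin n)

allF : {n : ℕ} → (Fin n → Bool) → Bool
allF {n} p = foldr (λ i b → p i ∧ b) true (allFin n)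

eqF : {n : ℕ} → Fin n → Fin n → Bool
eqF v w = ⌊ v ≟ w ⌋

-- number of classes of a (boolean) equivalence relation on Fin n:
-- the number of vertices that are the least element of their class
numClasses : {n : ℕ} → (Fin n → Fin n → Bool) → ℕ
numClasses R = count (λ w → allF (λ w' → not ((toℕ w' <ᵇ toℕ w) ∧ R w' w)))

record Graph (n : ℕ) : Set where
  field
    adj   : Fin n → Fin n → Bool
    sym   : ∀ v w → adj v w ≡ adj w v
    irrefl : ∀ v → adj v v ≡ false
open Graph public

Coloring : ℕ → Set
Coloring n = Fin n → ℕ

sameColor : {n : ℕ} → Coloring n → Fin n → Fin n → Bool
sameColor χ v w = χ v ≡ᵇ χ w

imSize : {n : ℕ} → Coloring n → ℕ
imSize χ = numClasses (sameColor χ)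

data Reach {n : ℕ} (G : Graph n) : Fin n → Fin n → Set where
  here : ∀ {v} → Reach G v v
  step : ∀ {u v w} → T (adj G u v) → Reach G v w → Reach G u w

Connected : {n : ℕ} → Graph n → Set
Connected G = ∀ v w → Reach G v w

pairColored : {n : ℕ} → Coloring n → ℕ → ℕ → Fin n → Fin n → Bool
pairColored χ c₁ c₂ v w =
  (toℕ v <ᵇ toℕ w) ∧
  (((χ v ≡ᵇ c₁) ∧ (χ w ≡ᵇ c₂)) ∨ ((χ v ≡ᵇ c₂) ∧ (χ w ≡ᵇ c₁)))

countPairs : {n : ℕ} → (Fin n → Fin n → Bool) → ℕ
countPairs {n} p =
  sum (map (λ v → count (λ w → (toℕ v <ᵇ toℕ w) ∧ p v w)) (allFin n))

colorPair : {n : ℕ} → Coloring n → ℕ → ℕ → Fin n → Fin n → Bool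
colorPair χ c₁ c₂ v w =
  ((χ v ≡ᵇ c₁) ∧ (χ w ≡ᵇ c₂)) ∨ ((χ v ≡ᵇ c₂) ∧ (χ w ≡ᵇ c₁))

numPairs : {n : ℕ} → Coloring n → ℕ → ℕ → ℕ
numPairs χ c₁ c₂ = countPairs (colorPair χ c₁ c₂)

numEdges : {n : ℕ} → Graph n → Coloring n → ℕ → ℕ → ℕ
numEdges G χ c₁ c₂ = countPairs (λ v w → adj G v w ∧ colorPair χ c₁ c₂ v w)

Flipped : {n : ℕ} → Graph n → Coloring n → Set
Flipped G χ = ∀ c₁ c₂ → 2 * numEdges G χ c₁ c₂ ≤ numPairs χ c₁ c₂

nbrCount : {n : ℕ} → Graph n → Coloring n → Fin n → ℕ → ℕ
nbrCount G χ v c = count (λ w → adj G v w ∧ (χ w ≡ᵇ c))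

Stable : {n : ℕ} → Graph n → Coloring n → Set
Stable G χ = ∀ v w c → χ v ≡ χ w → nbrCount G χ v c ≡ nbrCount G χ w c

Robust1 : {n : ℕ} → Graph n → Coloring n → Set
Robust1 G χ = Connected G × Flipped G χ × Stable G χ

-- One round: v ~' w iff v ~ w and for every class (represented by z)
-- v and w have the same number of neighbours in that class, i.e.
-- (old color, multiset of neighbour colors) agree.

refineStep : {n : ℕ} → Graph n → (Fin n → Fin n → Bool) → Fin n → Fin n → Bool
refineStep G R v w =
  R v w ∧ allF (λ z → count (λ x → adj G v x ∧ R z x)
                       ≡ᵇ count (λ x → adj G w x ∧ R z x))

iterate : {A : Set} → ℕ → (A → A) → A → A
iterate zero    f a = a
iterate (suc k) f a = f (iterate k f a)

-- the partition of χ[u]: u gets a fresh unique color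
individualize : {n : ℕ} → Coloring n → Fin n → Fin n → Fin n → Bool
individualize χ u v w =
  (eqF v u ∧ eqF w u) ∨ (not (eqF v u) ∧ not (eqF w u) ∧ (χ v ≡ᵇ χ w))

-- stable 1-WL partition of (G, χ[u]); n rounds suffice for a partition
-- of n vertices to stabilise
chi1 : {n : ℕ} → Graph n → Coloring n → Fin n → Fin n → Fin n → Bool
chi1 {n} G χ u = iterate n (refineStep G) (individualize χ u)

imSize1 : {n : ℕ} → Graph n → Coloring n → Fin n → ℕ
imSize1 G χ u = numClasses (chi1 G χ u)

-- deg_{G[[χ]]}(c): number of colors c₂ ∈ im(χ) (loops included) such
-- that G has an edge between χ⁻¹(c) and χ⁻¹(c₂).  Colors c₂ are
-- represented by the least vertex w of each color class.

quotDeg : {n : ℕ} → Graph n → Coloring n → ℕ → ℕ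
quotDeg G χ c =
  count (λ w → allF (λ w' → not ((toℕ w' <ᵇ toℕ w) ∧ (χ w' ≡ᵇ χ w)))
             ∧ anyF (λ v → anyF (λ x → (χ v ≡ᵇ c) ∧ (χ x ≡ᵇ χ w) ∧ adj G v x)))

-- Individualizing u splits the colour class of u: that class has a second vertex, because a
-- non-neighbour b of colour χ a, for a neighbour a of u, has by stability a neighbour of colour
-- χ u, which cannot be u.  One round of colour refinement then splits every colour class d adjacent
-- to χ u into neighbours and non-neighbours of u.  Both parts are nonempty: the first by stability,
-- the second because if u were adjacent to all of d (but itself), stability would make every
-- vertex of colour χ u adjacent to all of d, so that the edges between the two classes would be
-- as many as the pairs, contradicting flippedness.  Each split adds a colour, and further rounds
-- of refinement only refine, so |im χ₁,ᵤ| ≥ |im χ| + 1 + deg(χ u).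
--
-- Colours of a partition are counted through the least vertex of each class, and a refinement
-- gains at least one class for every coarse class it splits.
module Submission where

open import Data.Bool using (Bool; true; false; _∧_; _∨_; not; if_then_else_; T)
open import Data.Bool.Properties using (T-≡; T-not-≡; T-∧; T-∨; T?; ∧-identityʳ; ∧-zeroʳ)
open import Data.Empty using (⊥-elim)
open import Data.Fin using (Fin; zero; suc; toℕ; _≟_; punchIn)
open import Data.Fin.Properties using (suc-injective; 0≢1+n; toℕ-injective; any?; punchInᵢ≢i)
open import Data.List using (map; foldr)
open import Data.List.Base using (allFin)
open import Data.List.Properties using (map-tabulate; map-cong; foldr-map)
open import Data.Nat using (ℕ; zero; suc; _+_; _*_; _≤_; _<_; _≡ᵇ_; _<ᵇ_; z≤n; s≤s)
open import Data.Nat.ListAction using (sum)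
open import Data.Nat.Properties
  using (+-comm; +-assoc; +-suc; +-identityʳ; +-cancelˡ-≡; +-monoˡ-≤; +-monoʳ-≤; +-monoʳ-<;
         m≤m+n; m≤n+m; m<m+n; ≤-trans; ≤-reflexive; <-irrefl; <-cmp; ≡ᵇ⇒≡; ≡⇒≡ᵇ; <ᵇ⇒<; <⇒<ᵇ;
         module ≤-Reasoning)
import Data.Nat.Properties as ℕ
open import Data.Product using (∃; _×_; _,_; proj₁; proj₂)
open import Data.Sum using (inj₁; inj₂)
open import Function using (_∘_; id; _⇔_; mk⇔; Equivalence)
open import Level using (0ℓ)
open import Relation.Binary using (Rel; _⇒_; Symmetric; IsEquivalence; tri<; tri≈; tri>)
open import Relation.Binary.PropositionalEquality
open import Relation.Nullary using (¬_; yes; no)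
open import Relation.Nullary.Decidable using (toWitness; fromWitness; decidable-stable; ¬?; _×-dec_)

open import Defs hiding (sym)

open Equivalence using (to; from)

T-not : ∀ {b} → T (not b) ⇔ (¬ T b)
T-not {false} = mk⇔ (λ _ ()) _
T-not {true}  = mk⇔ (λ ()) (λ ¬t → ¬t _)

T-≡ᵇ : ∀ {m n} → T (m ≡ᵇ n) ⇔ m ≡ n
T-≡ᵇ {m} {n} = mk⇔ (≡ᵇ⇒≡ m n) (≡⇒≡ᵇ m n)

T⇒∧≡ : ∀ {a b} → (T b → T a) → a ∧ b ≡ b
T⇒∧≡ {a} {false} _   = ∧-zeroʳ a
T⇒∧≡ {a} {true}  b⇒a = trans (∧-identityʳ a) (to T-≡ (b⇒a _))

eqF-suc : ∀ {n} (i j : Fin n) → eqF (suc i) (suc j) ≡ eqF i j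
eqF-suc i j with i ≟ j
... | yes _ = refl
... | no _  = refl

sum-allFin-suc : ∀ {n} (f : Fin (suc n) → ℕ) →
                 sum (map f (allFin (suc n))) ≡ f zero + sum (map (f ∘ suc) (allFin n))
sum-allFin-suc f =
  cong (λ xs → f zero + sum xs) (trans (map-tabulate suc f) (sym (map-tabulate id (f ∘ suc))))

≤-sum-allFin : ∀ {n} (f : Fin n → ℕ) i → f i ≤ sum (map f (allFin n))
≤-sum-allFin f zero    rewrite sum-allFin-suc f = m≤m+n _ _
≤-sum-allFin f (suc i) rewrite sum-allFin-suc f = ≤-trans (≤-sum-allFin (f ∘ suc) i) (m≤n+m _ _)

foldr-allFin-suc : ∀ {n} {A : Set} (k : Fin (suc n) → A → A) (e : A) →
                   foldr k e (allFin (suc n)) ≡ k zero (foldr (k ∘ suc) e (allFin n))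
foldr-allFin-suc {n} k e =
  cong (k zero) (trans (cong (foldr k e) (sym (map-tabulate id suc))) (foldr-map k suc e (allFin n)))

T-allF : ∀ {n} {p : Fin n → Bool} → T (allF p) ⇔ (∀ i → T (p i))
T-allF {zero}      = mk⇔ (λ _ ()) _
T-allF {suc n} {p} = mk⇔ all⇒ all⇐
  where
  unfold : allF p ≡ p zero ∧ allF (p ∘ suc)
  unfold = foldr-allFin-suc (λ i b → p i ∧ b) true
  all⇒ : T (allF p) → ∀ i → T (p i)
  all⇒ h i with to (T-∧ {p zero}) (subst T unfold h)
  all⇒ h zero    | p₀ , _  = p₀
  all⇒ h (suc i) | _  , ps = to (T-allF {p = p ∘ suc}) ps i
  all⇐ : (∀ i → T (p i)) → T (allF p)
  all⇐ h = subst T (sym unfold) (from (T-∧ {p zero}) (h zero , from (T-allF {p = p ∘ suc}) (h ∘ suc)))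

T-anyF⇒ : ∀ {n} {p : Fin n → Bool} → T (anyF p) → ∃ (T ∘ p)
T-anyF⇒ {suc n} {p} h with to (T-∨ {p zero}) (subst T (foldr-allFin-suc (λ i b → p i ∨ b) false) h)
... | inj₁ p₀ = zero , p₀
... | inj₂ ps = let i , pᵢ = T-anyF⇒ ps in suc i , pᵢ

indicator : Bool → ℕ
indicator b = if b then 1 else 0

count-suc : ∀ {n} (p : Fin (suc n) → Bool) → count p ≡ indicator (p zero) + count (p ∘ suc)
count-suc p = sum-allFin-suc (indicator ∘ p)

count-cong : ∀ {n} {p q : Fin n → Bool} → (∀ i → p i ≡ q i) → count p ≡ count q
count-cong {n} p≡q = cong sum (map-cong (cong indicator ∘ p≡q) (allFin n))

count-split : ∀ {n} {p q : Fin n → Bool} → (∀ i → T (q i) → T (p i)) →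
              count p ≡ count q + count (λ i → p i ∧ not (q i))
count-split {zero} _ = refl
count-split {suc n} {p} {q} q⇒p
  rewrite count-suc p | count-suc q | count-suc (λ i → p i ∧ not (q i))
        | count-split {p = p ∘ suc} {q ∘ suc} (q⇒p ∘ suc)
  with p zero | q zero | q⇒p zero
... | true  | true  | _      = refl
... | true  | false | _      = sym (+-suc (count (q ∘ suc)) _)
... | false | true  | q₀⇒p₀ = ⊥-elim (q₀⇒p₀ _)
... | false | false | _      = refl

count-mono : ∀ {n} {p q : Fin n → Bool} → (∀ i → T (p i) → T (q i)) → count p ≤ count q
count-mono p⇒q = ≤-trans (m≤m+n _ _) (≤-reflexive (sym (count-split p⇒q)))

count-pos : ∀ {n} {p : Fin n → Bool} (i : Fin n) → T (p i) → 0 < count p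
count-pos {p = p} zero pᵢ rewrite count-suc p with p zero
... | true = s≤s z≤n
count-pos {p = p} (suc i) pᵢ rewrite count-suc p = ≤-trans (count-pos i pᵢ) (m≤n+m _ _)

count-pos⇒∃ : ∀ {n} {p : Fin n → Bool} → 0 < count p → ∃ (T ∘ p)
count-pos⇒∃ {suc n} {p} pos rewrite count-suc p with p zero in p₀
... | true  = zero , subst T (sym p₀) _
... | false = let i , pᵢ = count-pos⇒∃ pos in suc i , pᵢ

count-≡⇒⊇ : ∀ {n} {p q : Fin n → Bool} → (∀ i → T (p i) → T (q i)) → count p ≡ count q →
            ∀ i → T (q i) → T (p i)
count-≡⇒⊇ {p = p} {q} p⇒q p≡q i qᵢ with T? (p i)
... | yes pᵢ = pᵢ
... | no ¬pᵢ = ⊥-elim (<-irrefl refl (begin-strict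
  count p                                 ≡⟨ +-identityʳ (count p) ⟨
  count p + 0                             <⟨ +-monoʳ-< (count p) (count-pos i q∧¬pᵢ) ⟩
  count p + count (λ j → q j ∧ not (p j)) ≡⟨ count-split p⇒q ⟨
  count q                                 ≡⟨ p≡q ⟨
  count p                                 ∎))
  where
  open ≤-Reasoning
  q∧¬pᵢ : T (q i ∧ not (p i))
  q∧¬pᵢ = from T-∧ (qᵢ , from T-not ¬pᵢ)

punctured : ∀ {n} → (Fin n → Bool) → Fin n → Fin n → Bool
punctured p k j = p j ∧ not (eqF j k)

count-remove : ∀ {n} (p : Fin n → Bool) (k : Fin n) →
               count p ≡ indicator (p k) + count (punctured p k)
count-remove p zero
  rewrite count-suc p | count-suc (punctured p zero)
        | count-cong {p = λ j → p (suc j) ∧ true} (λ j → ∧-identityʳ (p (suc j)))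
  with p zero
... | true  = refl
... | false = refl
count-remove p (suc k)
  rewrite count-suc p | count-suc (punctured p (suc k)) | count-remove (p ∘ suc) k
        | count-cong {p = punctured p (suc k) ∘ suc} (λ j → cong (λ b → p (suc j) ∧ not b) (eqF-suc j k))
  with p zero
... | true  = sym (+-suc _ _)
... | false = refl

count-punctured : ∀ {n} (p : Fin n → Bool) {u v} → p u ≡ p v →
                  count (punctured p u) ≡ count (punctured p v)
count-punctured p {u} {v} pᵤ≡pᵥ = +-cancelˡ-≡ (indicator (p u)) _ _ (begin
  indicator (p u) + count (punctured p u) ≡⟨ count-remove p u ⟨
  count p                                  ≡⟨ count-remove p v ⟩
  indicator (p v) + count (punctured p v) ≡⟨ cong (λ b → indicator b + count (punctured p v)) pᵤ≡pᵥ ⟨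
  indicator (p u) + count (punctured p v) ∎)
  where open ≡-Reasoning

count-inj : ∀ {m n} {p : Fin m → Bool} {q : Fin n → Bool} (f : ∀ i → T (p i) → Fin n) →
            (∀ i pᵢ → T (q (f i pᵢ))) → (∀ i j pᵢ pⱼ → f i pᵢ ≡ f j pⱼ → i ≡ j) →
            count p ≤ count q
count-inj {zero} _ _ _ = z≤n
count-inj {suc m} {p = p} {q} f f∈q f-inj rewrite count-suc p with p zero in p₀
... | false = count-inj (f ∘ suc) (f∈q ∘ suc) f-inj′
  where
  f-inj′ : ∀ i j pᵢ pⱼ → f (suc i) pᵢ ≡ f (suc j) pⱼ → i ≡ j
  f-inj′ i j pᵢ pⱼ = suc-injective ∘ f-inj (suc i) (suc j) pᵢ pⱼ
... | true  = begin
  suc (count (p ∘ suc))                    ≤⟨ s≤s (count-inj (f ∘ suc) f∈q′ f-inj′) ⟩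
  suc (count (punctured q k))              ≡⟨ cong (λ b → indicator b + count (punctured q k)) qₖ ⟨
  indicator (q k) + count (punctured q k) ≡⟨ count-remove q k ⟨
  count q                                  ∎
  where
  open ≤-Reasoning
  p₀′ : T (p zero)
  p₀′ = subst T (sym p₀) _
  k : Fin _
  k = f zero p₀′
  qₖ : q k ≡ true
  qₖ = to T-≡ (f∈q zero p₀′)
  f-inj′ : ∀ i j pᵢ pⱼ → f (suc i) pᵢ ≡ f (suc j) pⱼ → i ≡ j
  f-inj′ i j pᵢ pⱼ = suc-injective ∘ f-inj (suc i) (suc j) pᵢ pⱼ
  f∈q′ : ∀ i pᵢ → T (punctured q k (f (suc i) pᵢ))
  f∈q′ i pᵢ = from T-∧ (f∈q (suc i) pᵢ ,
    from T-not (λ eq → 0≢1+n (f-inj zero (suc i) p₀′ pᵢ (sym (toWitness eq)))))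

countPairs-cong : ∀ {n} {p q : Fin n → Fin n → Bool} →
                  (∀ v w → toℕ v < toℕ w → p v w ≡ q v w) → countPairs p ≡ countPairs q
countPairs-cong {n} {p} {q} p≡q = cong sum (map-cong (λ v → count-cong (pointwise v)) (allFin n))
  where
  pointwise : ∀ v w → (toℕ v <ᵇ toℕ w) ∧ p v w ≡ (toℕ v <ᵇ toℕ w) ∧ q v w
  pointwise v w with toℕ v <ᵇ toℕ w in lt
  ... | true  = p≡q v w (<ᵇ⇒< _ _ (subst T (sym lt) _))
  ... | false = refl

countPairs-pos : ∀ {n} {p : Fin n → Fin n → Bool} {v w} → toℕ v < toℕ w → T (p v w) →
                 0 < countPairs p
countPairs-pos {p = p} {v} {w} v<w pᵥw = ≤-trans
  (count-pos w (from T-∧ (<⇒<ᵇ v<w , pᵥw)))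
  (≤-sum-allFin (λ v → count (λ w → (toℕ v <ᵇ toℕ w) ∧ p v w)) v)

⟦_⟧ : ∀ {n} → (Fin n → Fin n → Bool) → Rel (Fin n) 0ℓ
⟦ R ⟧ v w = T (R v w)

isLeast : ∀ {n} → (Fin n → Fin n → Bool) → Fin n → Bool
isLeast R w = allF (λ w′ → not ((toℕ w′ <ᵇ toℕ w) ∧ R w′ w))

T-isLeast : ∀ {n} {R : Fin n → Fin n → Bool} {w} →
            T (isLeast R w) ⇔ (∀ w′ → toℕ w′ < toℕ w → ¬ T (R w′ w))
T-isLeast {R = R} {w} = mk⇔
  (λ h w′ lt r → to T-not (to T-allF h w′) (from T-∧ (<⇒<ᵇ lt , r)))
  (λ h → from T-allF λ w′ → from T-not λ t →
    let lt , r = to (T-∧ {toℕ w′ <ᵇ toℕ w}) t in h w′ (<ᵇ⇒< _ _ lt) r)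

isLeast-anti : ∀ {n} {R R′ : Fin n → Fin n → Bool} → ⟦ R ⟧ ⇒ ⟦ R′ ⟧ →
               ∀ {w} → T (isLeast R′ w) → T (isLeast R w)
isLeast-anti {R = R} {R′} R⇒R′ h =
  from (T-isLeast {R = R}) λ w′ lt → to (T-isLeast {R = R′}) h w′ lt ∘ R⇒R′

isLeast-unique : ∀ {n} {R : Fin n → Fin n → Bool} → Symmetric ⟦ R ⟧ →
                 ∀ {a b} → T (isLeast R a) → T (isLeast R b) → T (R a b) → a ≡ b
isLeast-unique {R = R} R-sym {a} {b} least-a least-b r with <-cmp (toℕ a) (toℕ b)
... | tri< a<b _ _ = ⊥-elim (to (T-isLeast {R = R}) least-b a a<b r)
... | tri≈ _ a≡b _ = toℕ-injective a≡b
... | tri> _ _ b<a = ⊥-elim (to (T-isLeast {R = R}) least-a b b<a (R-sym r))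

numClasses-anti : ∀ {n} {R R′ : Fin n → Fin n → Bool} → ⟦ R ⟧ ⇒ ⟦ R′ ⟧ →
                  numClasses R′ ≤ numClasses R
numClasses-anti {R = R} {R′} R⇒R′ = count-mono λ w → isLeast-anti {R = R} {R′} R⇒R′ {w}

∃-least : ∀ {n} (p : Fin n → Bool) {v} → T (p v) →
          ∃ λ m → T (p m) × (∀ w → toℕ w < toℕ m → ¬ T (p w))
∃-least {suc n} p {v} pᵥ with p zero in p₀
... | true = zero , subst T (sym p₀) _ , λ _ ()
∃-least {suc n} p {zero}  pᵥ | false = ⊥-elim (subst T p₀ pᵥ)
∃-least {suc n} p {suc v} pᵥ | false with ∃-least (p ∘ suc) pᵥ
... | m , pₘ , least = suc m , pₘ , λ where
  zero    _        → subst (¬_ ∘ T) (sym p₀) id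
  (suc w) (s≤s lt) → least w lt

module Representative {n} {R : Fin n → Fin n → Bool} (R-equiv : IsEquivalence ⟦ R ⟧) where
  private
    module R = IsEquivalence R-equiv

    least-in-class : ∀ v → ∃ λ m → T (R m v) × (∀ w → toℕ w < toℕ m → ¬ T (R w v))
    least-in-class v = ∃-least (λ w → R w v) R.refl

  rep : Fin n → Fin n
  rep v = proj₁ (least-in-class v)

  rep-related : ∀ v → T (R (rep v) v)
  rep-related v = proj₁ (proj₂ (least-in-class v))

  rep-isLeast : ∀ v → T (isLeast R (rep v))
  rep-isLeast v = from (T-isLeast {R = R}) λ w lt r →
    proj₂ (proj₂ (least-in-class v)) w lt (R.trans r (rep-related v))

kernel-isEquivalence : ∀ {n} {A : Set} {R : Fin n → Fin n → Bool} (f : Fin n → A) →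
                       (∀ {v w} → T (R v w) ⇔ f v ≡ f w) → IsEquivalence ⟦ R ⟧
kernel-isEquivalence f R⇔ = record
  { refl  = from R⇔ refl
  ; sym   = λ r → from R⇔ (sym (to R⇔ r))
  ; trans = λ r s → from R⇔ (trans (to R⇔ r) (to R⇔ s))
  }

sameColor-isEquivalence : ∀ {n} (χ : Coloring n) → IsEquivalence ⟦ sameColor χ ⟧
sameColor-isEquivalence χ = kernel-isEquivalence χ T-≡ᵇ

-- Each vertex w satisfying P names the R′-class of `left w`, which R separates from `right w`;
-- distinct such vertices name distinct classes.
record Splitting {n} (R R′ : Fin n → Fin n → Bool) (P : Fin n → Bool) : Set where
  field
    left right : ∀ w → T (P w) → Fin n
    related    : ∀ w pw → T (R′ (left w pw) (right w pw))
    apart      : ∀ w pw → ¬ T (R (left w pw) (right w pw))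
    injective  : ∀ i j pᵢ pⱼ → T (R′ (left i pᵢ) (left j pⱼ)) → i ≡ j

numClasses-split : ∀ {n} {R R′ : Fin n → Fin n → Bool} {P : Fin n → Bool} →
                   IsEquivalence ⟦ R ⟧ → IsEquivalence ⟦ R′ ⟧ → ⟦ R ⟧ ⇒ ⟦ R′ ⟧ →
                   Splitting R R′ P → numClasses R′ + count P ≤ numClasses R
numClasses-split {n} {R} {R′} {P} R-equiv R′-equiv R⇒R′ S = begin
  numClasses R′ + count P
    ≤⟨ +-monoʳ-≤ (numClasses R′) (count-inj (λ w → proj₁ ∘ newClass w) newClass-new newClass-injective) ⟩
  count (isLeast R′) + count (λ w → isLeast R w ∧ not (isLeast R′ w))
    ≡⟨ count-split (λ w → isLeast-anti {R = R} {R′} R⇒R′ {w}) ⟨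
  numClasses R ∎
  where
  open ≤-Reasoning
  open Splitting S
  open Representative R-equiv
  module R  = IsEquivalence R-equiv
  module R′ = IsEquivalence R′-equiv

  rep-related′ : ∀ v → T (R′ v (rep v))
  rep-related′ v = R′.sym (R⇒R′ (rep-related v))

  -- The R′-least vertex of the class represents at most one of the R-classes of `left` and `right`.
  newClass : ∀ w pw → ∃ λ z → T (isLeast R z) × ¬ T (isLeast R′ z) × T (R′ (left w pw) z)
  newClass w pw with T? (isLeast R′ (rep (left w pw)))
  ... | no ¬least = rep (left w pw) , rep-isLeast _ , ¬least , rep-related′ _
  ... | yes least = rep r , rep-isLeast r , ¬least , R′.trans (related w pw) (rep-related′ r)
    where
    l r : Fin n
    l = left w pw
    r = right w pw
    ¬least : ¬ T (isLeast R′ (rep r))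
    ¬least least′ =
      apart w pw (R.trans (R.sym (rep-related l)) (subst (λ x → T (R x r)) (sym same) (rep-related r)))
      where
      same : rep l ≡ rep r
      same = isLeast-unique {R = R′} R′.sym least least′
        (R′.trans (R′.sym (rep-related′ l)) (R′.trans (related w pw) (rep-related′ r)))

  newClass-new : ∀ w pw → let z = proj₁ (newClass w pw) in T (isLeast R z ∧ not (isLeast R′ z))
  newClass-new w pw = let _ , least , ¬least′ , _ = newClass w pw in from T-∧ (least , from T-not ¬least′)

  newClass-injective : ∀ i j pᵢ pⱼ → proj₁ (newClass i pᵢ) ≡ proj₁ (newClass j pⱼ) → i ≡ j
  newClass-injective i j pᵢ pⱼ eq with newClass i pᵢ | newClass j pⱼ
  ... | _ , _ , _ , iz | _ , _ , _ , jz =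
    injective i j pᵢ pⱼ (R′.trans iz (subst (λ x → T (R′ x (left j pⱼ))) (sym eq) (R′.sym jz)))

module Individualize {n} (χ : Coloring n) (u : Fin n) where

  key : Fin n → Bool × ℕ
  key v = eqF v u , χ v

  T-individualize : ∀ {v w} → T (individualize χ u v w) ⇔ key v ≡ key w
  T-individualize {v} {w} with v ≟ u | w ≟ u
  ... | yes refl | yes refl = mk⇔ (λ _ → refl) _
  ... | yes _    | no _     = mk⇔ (λ ()) (λ ())
  ... | no _     | yes _    = mk⇔ (λ ()) (λ ())
  ... | no _     | no _     = mk⇔ (cong (false ,_) ∘ to T-≡ᵇ) (from T-≡ᵇ ∘ cong proj₂)

  individualize-isEquivalence : IsEquivalence ⟦ individualize χ u ⟧
  individualize-isEquivalence = kernel-isEquivalence key T-individualize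

  individualize-⇒ : ⟦ individualize χ u ⟧ ⇒ ⟦ sameColor χ ⟧
  individualize-⇒ = from T-≡ᵇ ∘ cong proj₂ ∘ to T-individualize

  individualize-singleton : ∀ {x} → T (individualize χ u u x) → x ≡ u
  individualize-singleton r =
    toWitness (subst T (cong proj₁ (to T-individualize r)) (fromWitness {a? = u ≟ u} refl))

  individualize-intro : ∀ {v w} → v ≢ u → w ≢ u → χ v ≡ χ w → T (individualize χ u v w)
  individualize-intro v≢u w≢u χv≡χw =
    from T-individualize (cong₂ _,_ (trans (eqF-false v≢u) (sym (eqF-false w≢u))) χv≡χw)
    where
    eqF-false : ∀ {x} → x ≢ u → eqF x u ≡ false
    eqF-false x≢u = to T-not-≡ (from T-not (x≢u ∘ toWitness))

  individualize-splitting : ∀ {z} → z ≢ u → χ z ≡ χ u →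
                            Splitting (individualize χ u) (sameColor χ) (λ w → eqF w u)
  individualize-splitting {z} z≢u χz≡χu = record
    { left      = λ _ _ → u
    ; right     = λ _ _ → z
    ; related   = λ _ _ → from T-≡ᵇ (sym χz≡χu)
    ; apart     = λ _ _ → z≢u ∘ individualize-singleton
    ; injective = λ _ _ pᵢ pⱼ _ → trans (toWitness pᵢ) (sym (toWitness pⱼ))
    }

module Refinement {n} (G : Graph n) where

  neighboursIn : (Fin n → Fin n → Bool) → Fin n → Fin n → ℕ
  neighboursIn R v z = count (λ x → adj G v x ∧ R z x)

  T-refineStep : ∀ {R v w} →
                 T (refineStep G R v w) ⇔ (T (R v w) × ∀ z → neighboursIn R v z ≡ neighboursIn R w z)
  T-refineStep {R} {v} {w} = mk⇔
    (λ r → let r₁ , r₂ = to (T-∧ {R v w}) r in r₁ , λ z → to T-≡ᵇ (to T-allF r₂ z))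
    (λ (r₁ , r₂) → from T-∧ (r₁ , from T-allF (from T-≡ᵇ ∘ r₂)))

  refineStep-isEquivalence : ∀ {R} → IsEquivalence ⟦ R ⟧ → IsEquivalence ⟦ refineStep G R ⟧
  refineStep-isEquivalence R-equiv = record
    { refl  = from T-refineStep (R.refl , λ _ → refl)
    ; sym   = λ r → let r₁ , r₂ = to T-refineStep r in from T-refineStep (R.sym r₁ , sym ∘ r₂)
    ; trans = λ r s → let r₁ , r₂ = to T-refineStep r ; s₁ , s₂ = to T-refineStep s in
        from T-refineStep (R.trans r₁ s₁ , λ z → trans (r₂ z) (s₂ z))
    }
    where module R = IsEquivalence R-equiv

  refineStep-⇒ : ∀ R → ⟦ refineStep G R ⟧ ⇒ ⟦ R ⟧
  refineStep-⇒ R = proj₁ ∘ to T-refineStep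

  iterate-refineStep-⇒ : ∀ {R} k → ⟦ iterate (suc k) (refineStep G) R ⟧ ⇒ ⟦ refineStep G R ⟧
  iterate-refineStep-⇒ zero    = id
  iterate-refineStep-⇒ (suc k) = iterate-refineStep-⇒ k ∘ refineStep-⇒ _

quotAdj : ∀ {n} → Graph n → Coloring n → ℕ → Fin n → Bool
quotAdj G χ c w = anyF (λ v → anyF (λ x → (χ v ≡ᵇ c) ∧ (χ x ≡ᵇ χ w) ∧ adj G v x))

reach-neighbour : ∀ {n} {G : Graph n} {v w} → Reach G v w → v ≢ w → ∃ (T ∘ adj G v)
reach-neighbour here        v≢v = ⊥-elim (v≢v refl)
reach-neighbour (step vx _) _   = _ , vx

connected⇒neighbour : ∀ {m} {G : Graph (suc (suc m))} → Connected G → ∀ u → ∃ (T ∘ adj G u)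
connected⇒neighbour connected u = reach-neighbour (connected u (punchIn u zero)) (punchInᵢ≢i u zero ∘ sym)

module ColourClasses {n} (G : Graph n) (χ : Coloring n) where

  adj-irrefl : ∀ {v w} → T (adj G v w) → v ≢ w
  adj-irrefl {v} vv refl = subst T (irrefl G v) vv

  adj-sym : ∀ {v w} → T (adj G v w) → T (adj G w v)
  adj-sym {v} {w} = subst T (Graph.sym G v w)

  stable-transfer : Stable G χ → ∀ {v w x} → χ v ≡ χ w → T (adj G v x) →
                    ∃ λ y → T (adj G w y) × χ y ≡ χ x
  stable-transfer stable {v} {w} {x} χv≡χw vx =
    let y , wy = count-pos⇒∃ (subst (0 <_) (stable v w (χ x) χv≡χw)
                   (count-pos x (from T-∧ (vx , from (T-≡ᵇ {χ x}) refl))))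
        wy₁ , wy₂ = to (T-∧ {adj G w y}) wy
    in y , wy₁ , to T-≡ᵇ wy₂

  quotAdj⇒neighbour : Stable G χ → ∀ {u w} → T (quotAdj G χ (χ u) w) →
                      ∃ λ a → T (adj G u a) × χ a ≡ χ w
  quotAdj⇒neighbour stable {u} {w} h =
    let v , h′          = T-anyF⇒ h
        x , r           = T-anyF⇒ h′
        vᵤ , r′         = to (T-∧ {χ v ≡ᵇ χ u}) r
        xw , vx         = to (T-∧ {χ x ≡ᵇ χ w}) r′
        a , ua , χa≡χx = stable-transfer stable (to T-≡ᵇ vᵤ) vx
    in a , ua , trans χa≡χx (to T-≡ᵇ xw)

  nbrCount-complete : ∀ {u d} → (∀ y → y ≢ u → χ y ≡ d → T (adj G u y)) →
                      nbrCount G χ u d ≡ count (punctured (λ y → χ y ≡ᵇ d) u)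
  nbrCount-complete {u} {d} complete = count-cong pointwise
    where
    pointwise : ∀ y → adj G u y ∧ (χ y ≡ᵇ d) ≡ (χ y ≡ᵇ d) ∧ not (eqF y u)
    pointwise y with y ≟ u
    ... | yes refl rewrite irrefl G u = sym (∧-zeroʳ (χ u ≡ᵇ d))
    ... | no y≢u with χ y ≡ᵇ d in χy
    ...   | false = ∧-zeroʳ (adj G u y)
    ...   | true  = trans (∧-identityʳ (adj G u y))
                          (to T-≡ (complete y y≢u (≡ᵇ⇒≡ _ _ (subst T (sym χy) _))))

  nbrCount-maximal : ∀ {v d} → nbrCount G χ v d ≡ count (punctured (λ y → χ y ≡ᵇ d) v) →
                     ∀ y → y ≢ v → χ y ≡ d → T (adj G v y)
  nbrCount-maximal {v} {d} eq y y≢v χy≡d = proj₁ (to (T-∧ {adj G v y})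
    (count-≡⇒⊇ neighbour⇒other eq y (from T-∧ (from T-≡ᵇ χy≡d , from T-not (y≢v ∘ toWitness)))))
    where
    neighbour⇒other : ∀ y → T (adj G v y ∧ (χ y ≡ᵇ d)) → T ((χ y ≡ᵇ d) ∧ not (eqF y v))
    neighbour⇒other y r = let vy , χy = to (T-∧ {adj G v y}) r in
      from T-∧ (χy , from T-not (adj-irrefl vy ∘ sym ∘ toWitness))

  stable-complete : Stable G χ → ∀ {u v d} → χ v ≡ χ u →
                    (∀ y → y ≢ u → χ y ≡ d → T (adj G u y)) →
                    ∀ y → y ≢ v → χ y ≡ d → T (adj G v y)
  stable-complete stable {u} {v} {d} χv≡χu complete = nbrCount-maximal (begin
    nbrCount G χ v d                        ≡⟨ stable v u d χv≡χu ⟩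
    nbrCount G χ u d                        ≡⟨ nbrCount-complete complete ⟩
    count (punctured (λ y → χ y ≡ᵇ d) u) ≡⟨ count-punctured (λ y → χ y ≡ᵇ d) (cong (_≡ᵇ d) (sym χv≡χu)) ⟩
    count (punctured (λ y → χ y ≡ᵇ d) v) ∎)
    where open ≡-Reasoning

  complete⇒numEdges≡numPairs : ∀ {c d} →
                               (∀ v → χ v ≡ c → ∀ y → y ≢ v → χ y ≡ d → T (adj G v y)) →
                               numEdges G χ c d ≡ numPairs χ c d
  complete⇒numEdges≡numPairs {c} {d} complete =
    countPairs-cong λ v w v<w → T⇒∧≡ (colourPair⇒adj (λ v≡w → <-irrefl (cong toℕ v≡w) v<w))
    where
    colourPair⇒adj : ∀ {v w} → v ≢ w → T (colorPair χ c d v w) → T (adj G v w)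
    colourPair⇒adj {v} {w} v≢w cp with to (T-∨ {(χ v ≡ᵇ c) ∧ (χ w ≡ᵇ d)}) cp
    ... | inj₁ r = let vc , wd = to (T-∧ {χ v ≡ᵇ c}) r in
      complete v (≡ᵇ⇒≡ _ _ vc) w (v≢w ∘ sym) (≡ᵇ⇒≡ _ _ wd)
    ... | inj₂ r = let vd , wc = to (T-∧ {χ v ≡ᵇ d}) r in
      adj-sym (complete w (≡ᵇ⇒≡ _ _ wc) v v≢w (≡ᵇ⇒≡ _ _ vd))

  numEdges-pos : ∀ {v w} → T (adj G v w) → 0 < numEdges G χ (χ v) (χ w)
  numEdges-pos {v} {w} vw with <-cmp (toℕ v) (toℕ w)
  ... | tri< v<w _ _ = countPairs-pos v<w
          (from T-∧ (vw , from T-∨ (inj₁ (from T-∧ (≡⇒≡ᵇ (χ v) _ refl , ≡⇒≡ᵇ (χ w) _ refl)))))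
  ... | tri≈ _ v≡w _ = ⊥-elim (adj-irrefl vw (toℕ-injective v≡w))
  ... | tri> _ _ w<v = countPairs-pos w<v
          (from T-∧ (adj-sym vw , from (T-∨ {(χ w ≡ᵇ χ v) ∧ (χ v ≡ᵇ χ w)})
            (inj₂ (from T-∧ (≡⇒≡ᵇ (χ w) _ refl , ≡⇒≡ᵇ (χ v) _ refl)))))

  flipped⇒numEdges<numPairs : Flipped G χ → ∀ {c d} → 0 < numEdges G χ c d →
                              numEdges G χ c d < numPairs χ c d
  flipped⇒numEdges<numPairs flipped {c} {d} pos = begin-strict
    E              <⟨ m<m+n E pos ⟩
    E + E          ≡⟨ cong (E +_) (+-identityʳ E) ⟨
    2 * E          ≤⟨ flipped c d ⟩
    numPairs χ c d ∎
    where
    open ≤-Reasoning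
    E = numEdges G χ c d

  flipped-nonNeighbour : Flipped G χ → Stable G χ → ∀ {u a} → T (adj G u a) →
                         ∃ λ b → b ≢ u × χ b ≡ χ a × ¬ T (adj G u b)
  flipped-nonNeighbour flipped stable {u} {a} ua
    with any? (λ b → ¬? (b ≟ u) ×-dec (χ b ℕ.≟ χ a) ×-dec ¬? (T? (adj G u b)))
  ... | yes found = found
  ... | no none = ⊥-elim (<-irrefl edges≡pairs (flipped⇒numEdges<numPairs flipped (numEdges-pos ua)))
    where
    complete : ∀ y → y ≢ u → χ y ≡ χ a → T (adj G u y)
    complete y y≢u χy≡χa = decidable-stable (T? _) λ ¬uy → none (y , y≢u , χy≡χa , ¬uy)
    edges≡pairs : numEdges G χ (χ u) (χ a) ≡ numPairs χ (χ u) (χ a)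
    edges≡pairs = complete⇒numEdges≡numPairs λ v χv≡χu → stable-complete stable χv≡χu complete

  sameColour-other : Flipped G χ → Stable G χ → ∀ {u a} → T (adj G u a) →
                     ∃ λ z → z ≢ u × χ z ≡ χ u
  sameColour-other flipped stable {u} ua =
    let b , _ , χb≡χa , ¬ub = flipped-nonNeighbour flipped stable ua
        z , bz , χz≡χu      = stable-transfer stable (sym χb≡χa) (adj-sym ua)
    in z , (λ z≡u → ¬ub (adj-sym (subst (T ∘ adj G b) z≡u bz))) , χz≡χu

  refineStep-individualize-apart : ∀ {u a b} → T (adj G a u) → ¬ T (adj G b u) →
                                   ¬ T (refineStep G (individualize χ u) a b)
  refineStep-individualize-apart {u} {a} {b} au ¬bu r =
    let x , bx∧ux = count-pos⇒∃ (subst (0 <_) (proj₂ (to T-refineStep r) u) neighbour-u)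
        bx , ux   = to (T-∧ {adj G b x}) bx∧ux
    in ¬bu (subst (T ∘ adj G b) (individualize-singleton ux) bx)
    where
    open Individualize χ u
    open Refinement G
    neighbour-u : 0 < neighboursIn (individualize χ u) a u
    neighbour-u = count-pos u (from T-∧ (au , IsEquivalence.refl individualize-isEquivalence {u}))

  refineStep-splitting : Flipped G χ → Stable G χ → ∀ u →
                         Splitting (refineStep G (individualize χ u)) (individualize χ u)
                                   (λ w → isLeast (sameColor χ) w ∧ quotAdj G χ (χ u) w)
  refineStep-splitting flipped stable u = record
    { left      = λ w pw → proj₁ (neighbour w pw)
    ; right     = λ w pw → proj₁ (nonNeighbour w pw)
    ; related   = λ w pw → let _ , ua , _ = neighbour w pw ; _ , b≢u , χb≡χa , _ = nonNeighbour w pw in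
                    individualize-intro (adj-irrefl ua ∘ sym) b≢u (sym χb≡χa)
    ; apart     = λ w pw → let _ , ua , _ = neighbour w pw ; _ , _ , _ , ¬ub = nonNeighbour w pw in
                    refineStep-individualize-apart (adj-sym ua) (¬ub ∘ adj-sym)
    ; injective = λ i j pᵢ pⱼ r → isLeast-unique {R = sameColor χ}
                    (IsEquivalence.sym (sameColor-isEquivalence χ)) (least i pᵢ) (least j pⱼ)
                    (from T-≡ᵇ (trans (sym (proj₂ (proj₂ (neighbour i pᵢ))))
                      (trans (cong proj₂ (to T-individualize r)) (proj₂ (proj₂ (neighbour j pⱼ))))))
    }
    where
    open Individualize χ u
    P : Fin n → Bool
    P w = isLeast (sameColor χ) w ∧ quotAdj G χ (χ u) w
    least : ∀ w → T (P w) → T (isLeast (sameColor χ) w)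
    least w = proj₁ ∘ to (T-∧ {isLeast (sameColor χ) w})
    neighbour : ∀ w → T (P w) → ∃ λ a → T (adj G u a) × χ a ≡ χ w
    neighbour w = quotAdj⇒neighbour stable ∘ proj₂ ∘ to (T-∧ {isLeast (sameColor χ) w})
    nonNeighbour : ∀ w pw → ∃ λ b → b ≢ u × χ b ≡ χ (proj₁ (neighbour w pw)) × ¬ T (adj G u b)
    nonNeighbour w pw = flipped-nonNeighbour flipped stable (proj₁ (proj₂ (neighbour w pw)))

  numClasses-individualize : Flipped G χ → Stable G χ → ∀ {u a} → T (adj G u a) →
                             imSize χ + 1 ≤ numClasses (individualize χ u)
  numClasses-individualize flipped stable {u} ua =
    let z , z≢u , χz≡χu = sameColour-other flipped stable ua in
    ≤-trans (+-monoʳ-≤ (imSize χ) (count-pos {p = λ w → eqF w u} u (fromWitness refl)))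
            (numClasses-split {R = individualize χ u} {R′ = sameColor χ}
               individualize-isEquivalence (sameColor-isEquivalence χ) individualize-⇒
               (individualize-splitting z≢u χz≡χu))
    where open Individualize χ u

  -- quotDeg G χ (χ u) is, by definition, the number of vertices w with
  -- isLeast (sameColor χ) w ∧ quotAdj G χ (χ u) w.
  numClasses-refineStep : Flipped G χ → Stable G χ → ∀ u →
                          numClasses (individualize χ u) + quotDeg G χ (χ u)
                            ≤ numClasses (refineStep G (individualize χ u))
  numClasses-refineStep flipped stable u =
    numClasses-split {R = refineStep G (individualize χ u)} {R′ = individualize χ u}
      (refineStep-isEquivalence individualize-isEquivalence) individualize-isEquivalence
      (λ {v w} → refineStep-⇒ (individualize χ u) {v} {w}) (refineStep-splitting flipped stable u)
    where
    open Individualize χ u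
    open Refinement G

lemma17 : {n : ℕ} (G : Graph n) (χ : Coloring n) →
    Robust1 G χ → 1 < n →
    (c : ℕ) →
    (u : Fin n) → χ u ≡ c →
    imSize χ + (quotDeg G χ c + 1) ≤ imSize1 G χ u
lemma17 {suc (suc m)} G χ (connected , flipped , stable) (s≤s (s≤s z≤n)) c u refl = begin
  imSize χ + (quotDeg G χ (χ u) + 1) ≡⟨ cong (imSize χ +_) (+-comm _ 1) ⟩
  imSize χ + (1 + quotDeg G χ (χ u)) ≡⟨ +-assoc (imSize χ) 1 _ ⟨
  imSize χ + 1 + quotDeg G χ (χ u)   ≤⟨ +-monoˡ-≤ _ (numClasses-individualize flipped stable ua) ⟩
  numClasses I + quotDeg G χ (χ u)   ≤⟨ numClasses-refineStep flipped stable u ⟩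
  numClasses (refineStep G I)        ≤⟨ numClasses-anti {R = chi1 G χ u} (iterate-refineStep-⇒ (suc m)) ⟩
  imSize1 G χ u                      ∎
  where
  open ≤-Reasoning
  open Refinement G
  open ColourClasses G χ
  I = individualize χ u
  ua = proj₂ (connected⇒neighbour connected u)
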